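{- Let $(N,\chi)$ be a weighted game with exactly two types of voters $N_1$ (more desirable) and $N_2$, with $r\ge 2$ shift-minimal winning coalitions and without null voters, and let $\mathcal{W}^s,\mathcal{L}^s$ be its sets of shift-minimal winning and shift-maximal losing coalitions. If real numbers $w_1,w_2,q\ge 0$ satisfy $m_1w_1+m_2w_2\ge q$ for all $(m_1,m_2)\in\mathcal{W}^s$ and $l_1w_1+l_2w_2\le q-1$ for all $(l_1,l_2)\in\mathcal{L}^s$, then $w_1\ge w_2+1$.
   Context: A simple game $\chi:2^N\to\{0,1\}$ is weighted if there are non-negative weights and a quota $q$ with $U$ winning iff its weight is $\ge q$. Types are the equivalence classes of Isbell's desirability relation. With two types of sizes $n_1,n_2$, coalitions are described by vectors $(m_1,m_2)$ of member counts; the order $\preceq$ is generated by $(m_1-1,m_2)\preceq(m_1,m_2)$, $(m_1,m_2-1)\preceq(m_1,m_2)$, $(m_1-1,m_2+1)\preceq(m_1,m_2)$; shift-minimal winning coalitions are the $\preceq$-minimal winning vectors, shift-maximal losing coalitions the $\preceq$-maximal losing vectors; $r$ is the number of shift-minimal winning coalitions. A null voter $i$ satisfies $\chi(U)=\chi(U\cup\{i\})$ for all $U$.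
   Formalization: The weights and quota of the weighted game, and the numbers $w_1,w_2,q$, are rational instead of real. -}

module Defs where

open import Data.Nat using (ℕ; zero; suc)
open import Data.Bool using (Bool; true; false; if_then_else_)
open import Data.Fin using (Fin)
import Data.Fin as F
open import Data.Fin.Subset using (Subset; _∈_; _∉_; _∪_; _∩_; ∁; ⁅_⁆; ∣_∣)
open import Data.Vec using ([]; _∷_)
open import Data.Integer using (+_)
open import Data.Rational using (ℚ; 0ℚ; _+_; _*_; _≤_; _/_)
open import Data.Product using (Σ; _×_; ∃; ∃-syntax; _,_)
open import Relation.Binary.PropositionalEquality using (_≡_; _≢_)
open import Relation.Binary.Construct.Closure.ReflexiveTransitive using (Star)
open import Relation.Nullary using (¬_)
open import Function.Bundles using (_⇔_)

-- A simple game on the voter set N = Fin n: coalitions are subsets,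
-- χ U ≡ true means U is winning.
Game : ℕ → Set
Game n = Subset n → Bool

ℕ→ℚ : ℕ → ℚ
ℕ→ℚ m = (+ m) / 1

weightOf : ∀ {n} → (Fin n → ℚ) → Subset n → ℚ
weightOf {zero} w [] = 0ℚ
weightOf {suc n} w (b ∷ U) = (if b then w F.zero else 0ℚ) + weightOf (λ i → w (F.suc i)) U

Weighted : ∀ {n} → Game n → Set
Weighted {n} χ = Σ (Fin n → ℚ) λ w → Σ ℚ λ q →
  (∀ i → 0ℚ ≤ w i) × (∀ U → (χ U ≡ true) ⇔ (q ≤ weightOf w U))

_⊒[_]_ : ∀ {n} → Fin n → Game n → Fin n → Set
i ⊒[ χ ] j = ∀ U → i ∉ U → j ∉ U → χ (U ∪ ⁅ j ⁆) ≡ true → χ (U ∪ ⁅ i ⁆) ≡ true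

_≈[_]_ : ∀ {n} → Fin n → Game n → Fin n → Set
i ≈[ χ ] j = (i ⊒[ χ ] j) × (j ⊒[ χ ] i)

TwoTypes : ∀ {n} → Game n → Subset n → Set
TwoTypes {n} χ N₁ =
  (∃[ i ] i ∈ N₁) × (∃[ j ] j ∉ N₁) ×
  (∀ i j → i ∈ N₁ → j ∈ N₁ → i ≈[ χ ] j) ×
  (∀ i j → i ∉ N₁ → j ∉ N₁ → i ≈[ χ ] j) ×
  (∀ i j → i ∈ N₁ → j ∉ N₁ → (i ⊒[ χ ] j) × ¬ (j ⊒[ χ ] i))

Null : ∀ {n} → Game n → Fin n → Set
Null χ i = ∀ U → χ U ≡ χ (U ∪ ⁅ i ⁆)

counts : ∀ {n} → Subset n → Subset n → ℕ × ℕ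
counts N₁ U = ∣ U ∩ N₁ ∣ , ∣ U ∩ ∁ N₁ ∣

data Step : ℕ × ℕ → ℕ × ℕ → Set where
  dec₁  : ∀ {m₁ m₂} → Step (m₁ , m₂) (suc m₁ , m₂)
  dec₂  : ∀ {m₁ m₂} → Step (m₁ , m₂) (m₁ , suc m₂)
  shift : ∀ {m₁ m₂} → Step (m₁ , suc m₂) (suc m₁ , m₂)

_⪯_ : ℕ × ℕ → ℕ × ℕ → Set
_⪯_ = Star Step

-- vector v is winning / losing: some coalition with this vector wins / loses
-- (all coalitions with the same vector have the same value in a two-type game)
WinV : ∀ {n} → Game n → Subset n → ℕ × ℕ → Set
WinV χ N₁ v = ∃[ U ] (counts N₁ U ≡ v) × (χ U ≡ true)

LoseV : ∀ {n} → Game n → Subset n → ℕ × ℕ → Set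
LoseV χ N₁ v = ∃[ U ] (counts N₁ U ≡ v) × (χ U ≡ false)

ShiftMinWin : ∀ {n} → Game n → Subset n → ℕ × ℕ → Set
ShiftMinWin χ N₁ v = WinV χ N₁ v × (∀ u → u ⪯ v → u ≢ v → ¬ WinV χ N₁ u)

ShiftMaxLose : ∀ {n} → Game n → Subset n → ℕ × ℕ → Set
ShiftMaxLose χ N₁ v = LoseV χ N₁ v × (∀ u → v ⪯ u → u ≢ v → ¬ LoseV χ N₁ u)

AtLeastTwoShiftMinWin : ∀ {n} → Game n → Subset n → Set
AtLeastTwoShiftMinWin χ N₁ =
  ∃[ u ] ∃[ v ] (u ≢ v) × ShiftMinWin χ N₁ u × ShiftMinWin χ N₁ v

{-# OPTIONS --safe #-}
-- Of two distinct shift-minimal winning vectors, the one with more members of N₁, say (a + 1, b),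
-- has b < ∣N₂∣, since the other one must not lie ⪯-below it.  Shifting one voter from N₁ to N₂
-- turns it into the losing vector (a, b + 1).  For the largest c with (a, c) losing, (a, c) is
-- shift-maximal losing: in a monotone game with two types the value of a coalition depends only
-- on its vector, and winning propagates ⪯-upwards from (a + 1, b), which lies ⪯-below every
-- vector ⪰ (a, c) with more than a members of N₁.  The two constraints then give
--   a w₁ + (b + 1) w₂ ≤ a w₁ + c w₂ ≤ q − 1 ≤ (a + 1) w₁ + b w₂ − 1,
-- that is w₂ + 1 ≤ w₁.
module Submission where

open import Defs
open import Data.Nat using (ℕ)
open import Data.Fin using (Fin)
open import Data.Fin.Subset using (Subset)
open import Data.Product using (_×_; _,_)
open import Relation.Nullary using (¬_)

open import Data.Bool using (Bool; true; false; if_then_else_)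
import Data.Bool as Bool
open import Data.Bool.Properties using (∨-identityʳ; ⇔→≡; ¬-not)
open import Data.Fin using (zero; suc)
open import Data.Fin.Subset using (_∈_; _∉_; _∪_; _∩_; ∁; ⁅_⁆; ∣_∣; ⊥; ⊤)
open import Data.Fin.Subset.Properties
  using (x∈p⇒x∉∁p; x∈∁p⇒x∉p; x∉p⇒x∈∁p; ∪-identityʳ; ∩-zeroˡ; ∩-identityˡ; ∣⊥∣≡0; ∣p∩q∣≤∣q∣;
         anySubset?)
import Data.Nat as ℕ
import Data.Nat.Properties as ℕ
open import Data.Product using (∃-syntax; proj₁; proj₂; map₁; map₂)
open import Data.Product.Properties using (≡-dec)
open import Data.Sum using (inj₁; inj₂)
open import Data.Vec using ([]; _∷_; here; there)
open import Function using (_∘_)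
open import Function.Bundles using (mk⇔; Equivalence)
open import Relation.Binary using (tri<; tri≈; tri>)
open import Relation.Binary.Construct.Closure.ReflexiveTransitive using (ε; _◅_; _◅◅_; fold)
open import Relation.Binary.PropositionalEquality
open import Relation.Nullary using (yes; no; contradiction)
open import Relation.Nullary.Decidable using (_×-dec_)
open import Relation.Unary using (Decidable)

-- The arithmetic of ℕ is opened only in this block: the statement below uses that of ℚ.
module _ where
  open import Data.Nat using (zero; suc; _+_; _∸_; _≤_; _<_; z≤n; s≤s; pred)

  greatest : ∀ {P : ℕ → Set} → Decidable P → ∀ k → (∀ {c} → P c → c ≤ k) →
             ∀ {c₀} → P c₀ → ∃[ c ] c₀ ≤ c × P c × (∀ {c′} → P c′ → c′ ≤ c)
  greatest P? zero    bounded Pc₀ = _ , ℕ.≤-refl , Pc₀ , λ Pc′ → ℕ.≤-trans (bounded Pc′) z≤n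
  greatest P? (suc k) bounded Pc₀ with P? (suc k)
  ... | yes Pk = suc k , bounded Pc₀ , Pk , bounded
  ... | no ¬Pk = greatest P? k (λ Pc → ℕ.≤-pred (ℕ.≤∧≢⇒< (bounded Pc) λ { refl → ¬Pk Pc })) Pc₀

  module StepClosure (P : ℕ → ℕ → Set) (K : ℕ)
    (P-suc₁  : ∀ {a b} → P a b → P (suc a) b)
    (P-suc₂  : ∀ {a b} → P a b → P a (suc b))
    (P-shift : ∀ {a b} → P a (suc b) → suc b ≤ K → P (suc a) b) where

    raise₁ : ∀ k {a b} → P a b → P (k + a) b
    raise₁ zero    p = p
    raise₁ (suc k) p = P-suc₁ (raise₁ k p)

    raise₂ : ∀ k {a b} → P a b → P a (k + b)
    raise₂ zero    p = p
    raise₂ (suc k) p = P-suc₂ (raise₂ k p)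

    shifts : ∀ k {a b} → P a (k + b) → k + b ≤ K → P (k + a) b
    shifts zero    p _ = p
    shifts (suc k) {a} {b} p k+b<K =
      subst (λ a′ → P a′ b) (ℕ.+-suc k a) (shifts k (P-shift p k+b<K) (ℕ.<⇒≤ k+b<K))

    upward : ∀ {x₁ x₂ y₁ y₂} → P x₁ x₂ → x₁ ≤ y₁ → x₁ + x₂ ≤ y₁ + y₂ → x₂ ≤ K → P y₁ y₂
    upward {x₁} {x₂} {y₁} {y₂} p x₁≤y₁ _ _ with ℕ.≤-total x₂ y₂
    ... | inj₁ x₂≤y₂ =
      subst₂ P (ℕ.m∸n+n≡m x₁≤y₁) (ℕ.m∸n+n≡m x₂≤y₂) (raise₁ (y₁ ∸ x₁) (raise₂ (y₂ ∸ x₂) p))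
    upward {x₁} {x₂} {y₁} {y₂} p _ x₁+x₂≤y₁+y₂ x₂≤K | inj₂ y₂≤x₂ =
      subst (λ a → P a y₂) (ℕ.m∸n+n≡m e+x₁≤y₁)
            (raise₁ (y₁ ∸ (e + x₁)) (shifts e (subst (P x₁) x₂≡ p) (subst (_≤ K) x₂≡ x₂≤K)))
      where
      e : ℕ
      e = x₂ ∸ y₂
      x₂≡ : x₂ ≡ e + y₂
      x₂≡ = sym (ℕ.m∸n+n≡m y₂≤x₂)
      e+x₁≤y₁ : e + x₁ ≤ y₁
      e+x₁≤y₁ = ℕ.+-cancelʳ-≤ y₂ (e + x₁) y₁ (begin
        e + x₁ + y₂   ≡⟨ cong (_+ y₂) (ℕ.+-comm e x₁) ⟩
        x₁ + e + y₂   ≡⟨ ℕ.+-assoc x₁ e y₂ ⟩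
        x₁ + (e + y₂) ≡⟨ cong (x₁ +_) x₂≡ ⟨
        x₁ + x₂       ≤⟨ x₁+x₂≤y₁+y₂ ⟩
        y₁ + y₂       ∎)
        where open ℕ.≤-Reasoning

  _≼_ : ℕ × ℕ → ℕ × ℕ → Set
  x ≼ y = proj₁ x ≤ proj₁ y × proj₁ x + proj₂ x ≤ proj₁ y + proj₂ y

  ≼-refl : ∀ {x} → x ≼ x
  ≼-refl = ℕ.≤-refl , ℕ.≤-refl

  ≼-trans : ∀ {x y z} → x ≼ y → y ≼ z → x ≼ z
  ≼-trans (p₁ , p₂) (q₁ , q₂) = ℕ.≤-trans p₁ q₁ , ℕ.≤-trans p₂ q₂

  Step⇒≼ : ∀ {x y} → Step x y → x ≼ y
  Step⇒≼ dec₁              = ℕ.n≤1+n _ , ℕ.n≤1+n _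
  Step⇒≼ (dec₂ {m₁} {m₂})  = ℕ.≤-refl , ℕ.+-monoʳ-≤ m₁ (ℕ.n≤1+n m₂)
  Step⇒≼ (shift {m₁} {m₂}) = ℕ.n≤1+n _ , ℕ.≤-reflexive (ℕ.+-suc m₁ m₂)

  ⪯⇒≼ : ∀ {x y} → x ⪯ y → x ≼ y
  ⪯⇒≼ = fold _≼_ (≼-trans ∘ Step⇒≼) ≼-refl

  ≼⇒⪯ : ∀ {x y} → x ≼ y → x ⪯ y
  ≼⇒⪯ {x₁ , x₂} (x₁≤y₁ , x₁+x₂≤y₁+y₂) = upward ε x₁≤y₁ x₁+x₂≤y₁+y₂ ℕ.≤-refl
    where
    open StepClosure (λ a b → (x₁ , x₂) ⪯ (a , b)) x₂
           (_◅◅ dec₁ ◅ ε) (_◅◅ dec₂ ◅ ε) (λ x⪯ _ → x⪯ ◅◅ shift ◅ ε)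

  ∉-there : ∀ {n x} {p : Subset n} {i} → i ∉ p → suc i ∉ x ∷ p
  ∉-there i∉p (there i∈p) = i∉p i∈p

  ∣∪⁅⁆∩∣-∈ : ∀ {n} (p r : Subset n) {i} → i ∉ p → i ∈ r → ∣ (p ∪ ⁅ i ⁆) ∩ r ∣ ≡ suc ∣ p ∩ r ∣
  ∣∪⁅⁆∩∣-∈ (true  ∷ p) r           {zero}  i∉p _           = contradiction here i∉p
  ∣∪⁅⁆∩∣-∈ (false ∷ p) (true  ∷ r) {zero}  _   _           = cong (λ p → suc ∣ p ∩ r ∣) (∪-identityʳ p)
  ∣∪⁅⁆∩∣-∈ (true  ∷ p) (true  ∷ r) {suc i} i∉p (there i∈r) = cong suc (∣∪⁅⁆∩∣-∈ p r (i∉p ∘ there) i∈r)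
  ∣∪⁅⁆∩∣-∈ (true  ∷ p) (false ∷ r) {suc i} i∉p (there i∈r) = ∣∪⁅⁆∩∣-∈ p r (i∉p ∘ there) i∈r
  ∣∪⁅⁆∩∣-∈ (false ∷ p) (true  ∷ r) {suc i} i∉p (there i∈r) = ∣∪⁅⁆∩∣-∈ p r (i∉p ∘ there) i∈r
  ∣∪⁅⁆∩∣-∈ (false ∷ p) (false ∷ r) {suc i} i∉p (there i∈r) = ∣∪⁅⁆∩∣-∈ p r (i∉p ∘ there) i∈r

  ∣∪⁅⁆∩∣-∉ : ∀ {n} (p r : Subset n) {i} → i ∉ r → ∣ (p ∪ ⁅ i ⁆) ∩ r ∣ ≡ ∣ p ∩ r ∣
  ∣∪⁅⁆∩∣-∉ (x     ∷ p) (true  ∷ r) {zero}  i∉r = contradiction here i∉r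
  ∣∪⁅⁆∩∣-∉ (true  ∷ p) (false ∷ r) {zero}  _   = cong (λ p → ∣ p ∩ r ∣) (∪-identityʳ p)
  ∣∪⁅⁆∩∣-∉ (false ∷ p) (false ∷ r) {zero}  _   = cong (λ p → ∣ p ∩ r ∣) (∪-identityʳ p)
  ∣∪⁅⁆∩∣-∉ (true  ∷ p) (true  ∷ r) {suc i} i∉r = cong suc (∣∪⁅⁆∩∣-∉ p r (i∉r ∘ there))
  ∣∪⁅⁆∩∣-∉ (true  ∷ p) (false ∷ r) {suc i} i∉r = ∣∪⁅⁆∩∣-∉ p r (i∉r ∘ there)
  ∣∪⁅⁆∩∣-∉ (false ∷ p) (true  ∷ r) {suc i} i∉r = ∣∪⁅⁆∩∣-∉ p r (i∉r ∘ there)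
  ∣∪⁅⁆∩∣-∉ (false ∷ p) (false ∷ r) {suc i} i∉r = ∣∪⁅⁆∩∣-∉ p r (i∉r ∘ there)

  x∈p⇒p≡q∪⁅x⁆ : ∀ {n} {p : Subset n} {i} → i ∈ p → ∃[ q ] i ∉ q × p ≡ q ∪ ⁅ i ⁆
  x∈p⇒p≡q∪⁅x⁆ {p = true ∷ p} here = false ∷ p , (λ ()) , cong (true ∷_) (sym (∪-identityʳ p))
  x∈p⇒p≡q∪⁅x⁆ {p = x ∷ p} (there i∈p) with x∈p⇒p≡q∪⁅x⁆ i∈p
  ... | q , i∉q , refl = x ∷ q , ∉-there i∉q , cong (_∷ (q ∪ ⁅ _ ⁆)) (sym (∨-identityʳ x))

  private
    ∃-there : ∀ {n x y z} {p q r : Subset n} →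
              ∃[ i ] i ∈ q × i ∈ r × i ∉ p → ∃[ i ] i ∈ y ∷ q × i ∈ z ∷ r × i ∉ x ∷ p
    ∃-there (i , i∈q , i∈r , i∉p) = suc i , there i∈q , there i∈r , ∉-there i∉p

  ∣p∩r∣<∣q∩r∣⇒∃ : ∀ {n} (p q r : Subset n) → ∣ p ∩ r ∣ < ∣ q ∩ r ∣ → ∃[ i ] i ∈ q × i ∈ r × i ∉ p
  ∣p∩r∣<∣q∩r∣⇒∃ []          []          []          ()
  ∣p∩r∣<∣q∩r∣⇒∃ (false ∷ p) (true  ∷ q) (true  ∷ r) _        = zero , here , here , λ ()
  ∣p∩r∣<∣q∩r∣⇒∃ (true  ∷ p) (true  ∷ q) (true  ∷ r) (s≤s lt) = ∃-there (∣p∩r∣<∣q∩r∣⇒∃ p q r lt)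
  ∣p∩r∣<∣q∩r∣⇒∃ (true  ∷ p) (false ∷ q) (true  ∷ r) lt       = ∃-there (∣p∩r∣<∣q∩r∣⇒∃ p q r (ℕ.<⇒≤ lt))
  ∣p∩r∣<∣q∩r∣⇒∃ (false ∷ p) (false ∷ q) (true  ∷ r) lt       = ∃-there (∣p∩r∣<∣q∩r∣⇒∃ p q r lt)
  ∣p∩r∣<∣q∩r∣⇒∃ (true  ∷ p) (true  ∷ q) (false ∷ r) lt       = ∃-there (∣p∩r∣<∣q∩r∣⇒∃ p q r lt)
  ∣p∩r∣<∣q∩r∣⇒∃ (true  ∷ p) (false ∷ q) (false ∷ r) lt       = ∃-there (∣p∩r∣<∣q∩r∣⇒∃ p q r lt)
  ∣p∩r∣<∣q∩r∣⇒∃ (false ∷ p) (true  ∷ q) (false ∷ r) lt       = ∃-there (∣p∩r∣<∣q∩r∣⇒∃ p q r lt)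
  ∣p∩r∣<∣q∩r∣⇒∃ (false ∷ p) (false ∷ q) (false ∷ r) lt       = ∃-there (∣p∩r∣<∣q∩r∣⇒∃ p q r lt)

  ∣p∩q∣>0⇒∃ : ∀ {n} (p q : Subset n) → 0 < ∣ p ∩ q ∣ → ∃[ i ] i ∈ p × i ∈ q
  ∣p∩q∣>0⇒∃ {n} p q 0<∣p∩q∣ =
    map₂ (λ { (i∈p , i∈q , _) → i∈p , i∈q })
         (∣p∩r∣<∣q∩r∣⇒∃ ⊥ p q (subst (_< ∣ p ∩ q ∣) (sym ∣⊥∩q∣≡0) 0<∣p∩q∣))
    where
    ∣⊥∩q∣≡0 : ∣ ⊥ ∩ q ∣ ≡ 0
    ∣⊥∩q∣≡0 = trans (cong ∣_∣ (∩-zeroˡ q)) (∣⊥∣≡0 n)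

  ∣p∩q∣<∣q∣⇒∃ : ∀ {n} (p q : Subset n) → ∣ p ∩ q ∣ < ∣ q ∣ → ∃[ i ] i ∈ q × i ∉ p
  ∣p∩q∣<∣q∣⇒∃ p q ∣p∩q∣<∣q∣ =
    map₂ (λ { (_ , i∈q , i∉p) → i∈q , i∉p })
         (∣p∩r∣<∣q∩r∣⇒∃ p ⊤ q (subst (∣ p ∩ q ∣ <_) (sym (cong ∣_∣ (∩-identityˡ q))) ∣p∩q∣<∣q∣))

  module _ {n} (S : Subset n) where

    counts-∪⁅⁆-∈ : ∀ {U i} → i ∉ U → i ∈ S → counts S (U ∪ ⁅ i ⁆) ≡ map₁ suc (counts S U)
    counts-∪⁅⁆-∈ {U} i∉U i∈S = cong₂ _,_ (∣∪⁅⁆∩∣-∈ U S i∉U i∈S) (∣∪⁅⁆∩∣-∉ U (∁ S) (x∈p⇒x∉∁p i∈S))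

    counts-∪⁅⁆-∉ : ∀ {U i} → i ∉ U → i ∉ S → counts S (U ∪ ⁅ i ⁆) ≡ map₂ suc (counts S U)
    counts-∪⁅⁆-∉ {U} i∉U i∉S = cong₂ _,_ (∣∪⁅⁆∩∣-∉ U S i∉S) (∣∪⁅⁆∩∣-∈ U (∁ S) i∉U (x∉p⇒x∈∁p i∉S))

    remove-∈ : ∀ U {a b} → counts S U ≡ (suc a , b) →
               ∃[ i ] ∃[ W ] i ∈ S × i ∉ W × U ≡ W ∪ ⁅ i ⁆ × counts S W ≡ (a , b)
    remove-∈ U U↦ with ∣p∩q∣>0⇒∃ U S (subst (0 <_) (sym (cong proj₁ U↦)) (s≤s z≤n))
    ... | i , i∈U , i∈S with x∈p⇒p≡q∪⁅x⁆ i∈U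
    ... | W , i∉W , refl =
      i , W , i∈S , i∉W , refl , cong (map₁ pred) (trans (sym (counts-∪⁅⁆-∈ i∉W i∈S)) U↦)

    remove-∉ : ∀ U {a b} → counts S U ≡ (a , suc b) →
               ∃[ i ] ∃[ W ] i ∉ S × i ∉ W × U ≡ W ∪ ⁅ i ⁆ × counts S W ≡ (a , b)
    remove-∉ U U↦ with ∣p∩q∣>0⇒∃ U (∁ S) (subst (0 <_) (sym (cong proj₂ U↦)) (s≤s z≤n))
    ... | i , i∈U , i∈∁S with x∈p⇒p≡q∪⁅x⁆ i∈U
    ... | W , i∉W , refl =
      i , W , x∈∁p⇒x∉p i∈∁S , i∉W , refl ,
      cong (map₂ pred) (trans (sym (counts-∪⁅⁆-∉ i∉W (x∈∁p⇒x∉p i∈∁S))) U↦)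

    add-∉ : ∀ W {a b} → counts S W ≡ (a , b) → b < ∣ ∁ S ∣ →
            ∃[ j ] j ∉ S × j ∉ W × counts S (W ∪ ⁅ j ⁆) ≡ (a , suc b)
    add-∉ W W↦ b<∣∁S∣ with ∣p∩q∣<∣q∣⇒∃ W (∁ S) (subst (_< ∣ ∁ S ∣) (sym (cong proj₂ W↦)) b<∣∁S∣)
    ... | j , j∈∁S , j∉W =
      j , x∈∁p⇒x∉p j∈∁S , j∉W , trans (counts-∪⁅⁆-∉ j∉W (x∈∁p⇒x∉p j∈∁S)) (cong (map₂ suc) W↦)

    counts₂≤∣∁S∣ : ∀ U {a b} → counts S U ≡ (a , b) → b ≤ ∣ ∁ S ∣
    counts₂≤∣∁S∣ U U↦ = subst (_≤ ∣ ∁ S ∣) (cong proj₂ U↦) (∣p∩q∣≤∣q∣ U (∁ S))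

  counts-tail : ∀ {n} b s (S V U : Subset n) →
                counts (s ∷ S) (b ∷ V) ≡ counts (s ∷ S) (b ∷ U) → counts S V ≡ counts S U
  counts-tail true  true  _ _ _ eq = cong (map₁ pred) eq
  counts-tail true  false _ _ _ eq = cong (map₂ pred) eq
  counts-tail false true  _ _ _ eq = eq
  counts-tail false false _ _ _ eq = eq

  Homogeneous : ∀ {n} → Game n → Subset n → Set
  Homogeneous χ T = ∀ i j → i ∈ T → j ∈ T → i ⊒[ χ ] j

  HomogeneousParts : ∀ {n} → Game n → Subset n → Set
  HomogeneousParts χ S = Homogeneous χ S × Homogeneous χ (∁ S)

  restrict : ∀ {n} → Game (suc n) → Bool → Game n
  restrict χ b W = χ (b ∷ W)

  homogeneous-restrict : ∀ {n} (χ : Game (suc n)) {s T} b →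
                         Homogeneous χ (s ∷ T) → Homogeneous (restrict χ b) T
  homogeneous-restrict χ true  hom i j i∈T j∈T U i∉U j∉U =
    hom (suc i) (suc j) (there i∈T) (there j∈T) (true ∷ U) (∉-there i∉U) (∉-there j∉U)
  homogeneous-restrict χ false hom i j i∈T j∈T U i∉U j∉U =
    hom (suc i) (suc j) (there i∈T) (there j∈T) (false ∷ U) (∉-there i∉U) (∉-there j∉U)

  homogeneousParts-restrict : ∀ {n} (χ : Game (suc n)) {s S} b →
                              HomogeneousParts χ (s ∷ S) → HomogeneousParts (restrict χ b) S
  homogeneousParts-restrict χ b (hS , h∁S) = homogeneous-restrict χ b hS , homogeneous-restrict χ b h∁S

  homogeneous-swap : ∀ {n} (χ : Game n) {T} W {i j} → Homogeneous χ T → i ∈ T → j ∈ T → i ∉ W → j ∉ W →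
                     χ (W ∪ ⁅ i ⁆) ≡ χ (W ∪ ⁅ j ⁆)
  homogeneous-swap χ W hom i∈T j∈T i∉W j∉W =
    ⇔→≡ (mk⇔ (hom _ _ j∈T i∈T W j∉W i∉W) (hom _ _ i∈T j∈T W i∉W j∉W))

  swap-head : ∀ {n} (χ : Game (suc n)) {T V p} → Homogeneous χ (true ∷ T) → p ∈ T → p ∉ V →
              χ (true ∷ V) ≡ χ (false ∷ (V ∪ ⁅ p ⁆))
  swap-head χ {V = V} hom p∈T p∉V =
    trans (cong (restrict χ true) (sym (∪-identityʳ V)))
          (homogeneous-swap χ (false ∷ V) hom here (there p∈T) (λ ()) (∉-there p∉V))

  counts-determine-value : ∀ {n} (χ : Game n) S → HomogeneousParts χ S →
                           ∀ V U → counts S V ≡ counts S U → χ V ≡ χ U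
  counts-determine-value-head : ∀ {n} (χ : Game (suc n)) s S → HomogeneousParts χ (s ∷ S) →
                                ∀ V U → counts (s ∷ S) (true ∷ V) ≡ counts (s ∷ S) (false ∷ U) →
                                χ (true ∷ V) ≡ χ (false ∷ U)

  counts-determine-value χ []      _     []        []        _  = refl
  counts-determine-value χ (s ∷ S) parts (true ∷ V)  (true ∷ U)  eq =
    counts-determine-value (restrict χ true) S (homogeneousParts-restrict χ true parts) V U
                           (counts-tail true s S V U eq)
  counts-determine-value χ (s ∷ S) parts (false ∷ V) (false ∷ U) eq =
    counts-determine-value (restrict χ false) S (homogeneousParts-restrict χ false parts) V U
                           (counts-tail false s S V U eq)
  counts-determine-value χ (s ∷ S) parts (true ∷ V)  (false ∷ U) eq =
    counts-determine-value-head χ s S parts V U eq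
  counts-determine-value χ (s ∷ S) parts (false ∷ V) (true ∷ U)  eq =
    sym (counts-determine-value-head χ s S parts U V (sym eq))

  -- The head voter lies in V but not in U; inside V it is exchanged for a voter of its own type
  -- from U ∖ V, which exists because V and U have equally many voters of that type.
  counts-determine-value-head χ true S parts@(hS , _) V U eq
    with ∣p∩r∣<∣q∩r∣⇒∃ V U S (ℕ.≤-reflexive (cong proj₁ eq))
  ... | p , _ , p∈S , p∉V =
    trans (swap-head χ hS p∈S p∉V)
          (counts-determine-value (restrict χ false) S (homogeneousParts-restrict χ false parts)
                                  (V ∪ ⁅ p ⁆) U (trans (counts-∪⁅⁆-∈ S p∉V p∈S) eq))
  counts-determine-value-head χ false S parts@(_ , h∁S) V U eq
    with ∣p∩r∣<∣q∩r∣⇒∃ V U (∁ S) (ℕ.≤-reflexive (cong proj₂ eq))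
  ... | p , _ , p∈∁S , p∉V =
    trans (swap-head χ h∁S p∈∁S p∉V)
          (counts-determine-value (restrict χ false) S (homogeneousParts-restrict χ false parts)
                                  (V ∪ ⁅ p ⁆) U (trans (counts-∪⁅⁆-∉ S p∉V (x∈∁p⇒x∉p p∈∁S)) eq))

  LoseV? : ∀ {n} (χ : Game n) S → Decidable (LoseV χ S)
  LoseV? χ S v = anySubset? (λ U → ≡-dec ℕ._≟_ ℕ._≟_ (counts S U) v ×-dec (χ U Bool.≟ false))

  module _ {n} {χ : Game n} {S : Subset n} where

    winV-bound : ∀ {a b} → WinV χ S (a , b) → b ≤ ∣ ∁ S ∣
    winV-bound (U , U↦ , _) = counts₂≤∣∁S∣ S U U↦

    loseV-bound : ∀ {a b} → LoseV χ S (a , b) → b ≤ ∣ ∁ S ∣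
    loseV-bound (U , U↦ , _) = counts₂≤∣∁S∣ S U U↦

    shiftMinWin-antichain : ∀ {u v} → ShiftMinWin χ S u → ShiftMinWin χ S v → u ⪯ v → u ≡ v
    shiftMinWin-antichain {u} {v} (u-wins , _) (_ , v-minimal) u⪯v with ≡-dec ℕ._≟_ ℕ._≟_ u v
    ... | yes u≡v = u≡v
    ... | no  u≢v = contradiction u-wins (v-minimal u u⪯v u≢v)

    shiftMinWin-gap : ∀ {a₁ b₁ a b} → ShiftMinWin χ S (a₁ , b₁) → ShiftMinWin χ S (suc a , b) →
                      a₁ ≤ a → b < b₁
    shiftMinWin-gap {a₁} {b₁} {a} {b} u v a₁≤a with a₁ + b₁ ℕ.≤? suc a + b
    ... | yes u-below =
      contradiction (cong proj₁ (shiftMinWin-antichain u v (≼⇒⪯ (ℕ.m≤n⇒m≤1+n a₁≤a , u-below))))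
                    (ℕ.<⇒≢ (s≤s a₁≤a))
    ... | no  u-above = ℕ.+-cancelˡ-≤ a (suc b) b₁ (begin
      a + suc b ≡⟨ ℕ.+-suc a b ⟩
      suc a + b <⟨ ℕ.≰⇒> u-above ⟩
      a₁ + b₁   ≤⟨ ℕ.+-monoˡ-≤ b₁ a₁≤a ⟩
      a + b₁    ∎)
      where open ℕ.≤-Reasoning

    shiftable-shiftMinWin : AtLeastTwoShiftMinWin χ S →
                            ∃[ a ] ∃[ b ] ShiftMinWin χ S (suc a , b) × b < ∣ ∁ S ∣
    shiftable-shiftMinWin ((a₁ , b₁) , (a₂ , b₂) , u≢v , u , v) with ℕ.<-cmp a₁ a₂
    ... | tri< (s≤s a₁≤a) _ _ = _ , b₂ , v , ℕ.<-≤-trans (shiftMinWin-gap u v a₁≤a) (winV-bound (proj₁ u))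
    ... | tri> _ _ (s≤s a₂≤a) = _ , b₁ , u , ℕ.<-≤-trans (shiftMinWin-gap v u a₂≤a) (winV-bound (proj₁ v))
    ... | tri≈ _ refl _ with ℕ.≤-total b₁ b₂
    ...   | inj₁ b₁≤b₂ =
      contradiction (shiftMinWin-antichain u v (≼⇒⪯ (ℕ.≤-refl , ℕ.+-monoʳ-≤ a₁ b₁≤b₂))) u≢v
    ...   | inj₂ b₂≤b₁ =
      contradiction (sym (shiftMinWin-antichain v u (≼⇒⪯ (ℕ.≤-refl , ℕ.+-monoʳ-≤ a₁ b₂≤b₁)))) u≢v

    shiftMinWin-shift-loses : ∀ {a b} → ShiftMinWin χ S (suc a , b) → b < ∣ ∁ S ∣ → LoseV χ S (a , suc b)
    shiftMinWin-shift-loses {a} {b} ((V , V↦ , _) , minimal) b<∣∁S∣ with remove-∈ S V V↦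
    ... | _ , W , _ , _ , _ , W↦ with add-∉ S W W↦ b<∣∁S∣
    ... | j , _ , _ , W+j↦ =
      W ∪ ⁅ j ⁆ , W+j↦ , ¬-not (λ wins → minimal (a , suc b) (shift ◅ ε) shifted≢ (W ∪ ⁅ j ⁆ , W+j↦ , wins))
      where
      shifted≢ : (a , suc b) ≢ (suc a , b)
      shifted≢ eq = ℕ.1+n≢n (sym (cong proj₁ eq))

  Dominant : ∀ {n} → Game n → Subset n → Set
  Dominant χ S = ∀ i j → i ∈ S → j ∉ S → i ⊒[ χ ] j

  twoTypes⇒homogeneousParts : ∀ {n} (χ : Game n) {S} → TwoTypes χ S → HomogeneousParts χ S
  twoTypes⇒homogeneousParts χ (_ , _ , same₁ , same₂ , _) =
    (λ i j i∈S j∈S → proj₁ (same₁ i j i∈S j∈S)) ,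
    (λ i j i∈∁S j∈∁S → proj₁ (same₂ i j (x∈∁p⇒x∉p i∈∁S) (x∈∁p⇒x∉p j∈∁S)))

  twoTypes⇒dominant : ∀ {n} (χ : Game n) {S} → TwoTypes χ S → Dominant χ S
  twoTypes⇒dominant χ (_ , _ , _ , _ , more) i j i∈S j∉S = proj₁ (more i j i∈S j∉S)

  -- Holds vacuously for vectors that no coalition realizes, hence the bound ∣ ∁ S ∣ on shifting.
  AllWin : ∀ {n} → Game n → Subset n → ℕ × ℕ → Set
  AllWin χ S v = ∀ U → counts S U ≡ v → χ U ≡ true

  Monotone : ∀ {n} → Game n → Set
  Monotone χ = ∀ U i → χ U ≡ true → χ (U ∪ ⁅ i ⁆) ≡ true

  module TwoTypeGame {n} (χ : Game n) (S : Subset n) (monotone : Monotone χ)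
    (parts : HomogeneousParts χ S) (dominant : Dominant χ S) where

    WinV⇒AllWin : ∀ {v} → WinV χ S v → AllWin χ S v
    WinV⇒AllWin (V , V↦ , V-wins) U U↦ =
      trans (counts-determine-value χ S parts U V (trans U↦ (sym V↦))) V-wins

    allWin-suc₁ : ∀ {a b} → AllWin χ S (a , b) → AllWin χ S (suc a , b)
    allWin-suc₁ win U U↦ with remove-∈ S U U↦
    ... | i , W , _ , _ , refl , W↦ = monotone W i (win W W↦)

    allWin-suc₂ : ∀ {a b} → AllWin χ S (a , b) → AllWin χ S (a , suc b)
    allWin-suc₂ win U U↦ with remove-∉ S U U↦
    ... | i , W , _ , _ , refl , W↦ = monotone W i (win W W↦)

    allWin-shift : ∀ {a b} → AllWin χ S (a , suc b) → suc b ≤ ∣ ∁ S ∣ → AllWin χ S (suc a , b)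
    allWin-shift win b<∣∁S∣ U U↦ with remove-∈ S U U↦
    ... | i , W , i∈S , i∉W , refl , W↦ with add-∉ S W W↦ b<∣∁S∣
    ... | j , j∉S , j∉W , W+j↦ = dominant i j i∈S j∉S W i∉W j∉W (win (W ∪ ⁅ j ⁆) W+j↦)

    allWin-upward : ∀ {x₁ x₂ y} → AllWin χ S (x₁ , x₂) → (x₁ , x₂) ≼ y → x₂ ≤ ∣ ∁ S ∣ → AllWin χ S y
    allWin-upward win (x₁≤y₁ , x₁+x₂≤y₁+y₂) = upward win x₁≤y₁ x₁+x₂≤y₁+y₂
      where open StepClosure (λ a b → AllWin χ S (a , b)) ∣ ∁ S ∣ allWin-suc₁ allWin-suc₂ allWin-shift

    losing-partner : ∀ {a b} → ShiftMinWin χ S (suc a , b) → b < ∣ ∁ S ∣ →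
                     ∃[ c ] suc b ≤ c × ShiftMaxLose χ S (a , c)
    losing-partner {a} {b} winner b<∣∁S∣
      with greatest (λ c → LoseV? χ S (a , c)) ∣ ∁ S ∣ loseV-bound (shiftMinWin-shift-loses winner b<∣∁S∣)
    ... | c , b<c , loses , c-greatest = c , b<c , loses , maximal
      where
      maximal : ∀ u → (a , c) ⪯ u → u ≢ (a , c) → ¬ LoseV χ S u
      maximal (u₁ , u₂) ac⪯u u≢ac (Y , Y↦ , Y-loses) with ⪯⇒≼ ac⪯u | u₁ ℕ.≟ a
      ... | _ , a+c≤a+u₂ | yes refl =
        u≢ac (cong (a ,_) (ℕ.≤-antisym (c-greatest (Y , Y↦ , Y-loses)) (ℕ.+-cancelˡ-≤ a c u₂ a+c≤a+u₂)))
      ... | a≤u₁ , a+c≤u₁+u₂ | no u₁≢a = contradiction (trans (sym Y-wins) Y-loses) λ ()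
        where
        winner≼u : (suc a , b) ≼ (u₁ , u₂)
        winner≼u = ℕ.≤∧≢⇒< a≤u₁ (u₁≢a ∘ sym) ,
                   ℕ.≤-trans (ℕ.≤-reflexive (sym (ℕ.+-suc a b))) (ℕ.≤-trans (ℕ.+-monoʳ-≤ a b<c) a+c≤u₁+u₂)
        Y-wins : χ Y ≡ true
        Y-wins = allWin-upward (WinV⇒AllWin (proj₁ winner)) winner≼u (ℕ.<⇒≤ b<∣∁S∣) Y Y↦

open import Data.Rational using (ℚ; 0ℚ; 1ℚ; _+_; _-_; _*_; _≤_)
open import Data.Integer using (+_)
import Data.Integer as ℤ
import Data.Integer.Properties as ℤ
import Data.Nat.Coprimality as Coprime
import Data.Rational as ℚ
import Data.Rational.Properties as ℚ
open import Data.Rational.Solver using (module +-*-Solver)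
import Data.Rational.Unnormalised as ℚᵘ
import Data.Rational.Unnormalised.Properties as ℚᵘ

ℕ→ℚ≡mkℚ : ∀ m → ℕ→ℚ m ≡ ℚ.mkℚ (+ m) 0 (Coprime.sym (Coprime.1-coprimeTo m))
ℕ→ℚ≡mkℚ m = ℚ.normalize-coprime (Coprime.sym (Coprime.1-coprimeTo m))

ℕ→ℚ-suc : ∀ m → ℕ→ℚ (ℕ.suc m) ≡ 1ℚ + ℕ→ℚ m
ℕ→ℚ-suc m rewrite ℕ→ℚ≡mkℚ (ℕ.suc m) | ℕ→ℚ≡mkℚ m =
  ℚ.toℚᵘ-injective
    (ℚᵘ.≃-trans (ℚᵘ.*≡* cross-multiplied)
                (ℚᵘ.≃-sym (ℚ.toℚᵘ-homo-+ 1ℚ (ℚ.mkℚ (+ m) 0 (Coprime.sym (Coprime.1-coprimeTo m))))))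
  where
  cross-multiplied : + ℕ.suc m ℤ.* + 1 ≡ (+ 1 ℤ.* + 1 ℤ.+ + m ℤ.* + 1) ℤ.* + 1
  cross-multiplied = trans (ℤ.*-identityʳ (+ ℕ.suc m))
    (sym (trans (ℤ.*-identityʳ _) (cong (ℤ._+_ (+ 1)) (ℤ.*-identityʳ (+ m)))))

ℕ→ℚ-mono-≤ : ∀ {m k} → m ℕ.≤ k → ℕ→ℚ m ≤ ℕ→ℚ k
ℕ→ℚ-mono-≤ {m} {k} m≤k rewrite ℕ→ℚ≡mkℚ m | ℕ→ℚ≡mkℚ k =
  ℚ.*≤* (subst₂ ℤ._≤_ (sym (ℤ.*-identityʳ (+ m))) (sym (ℤ.*-identityʳ (+ k))) (ℤ.+≤+ m≤k))

weightOf-∪ : ∀ {n} (w : Fin n → ℚ) → (∀ i → 0ℚ ≤ w i) → ∀ A B → weightOf w A ≤ weightOf w (A ∪ B)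
weightOf-∪ w 0≤w []      []      = ℚ.≤-refl
weightOf-∪ w 0≤w (a ∷ A) (b ∷ B) = ℚ.+-mono-≤ (head a b) (weightOf-∪ (w ∘ suc) (0≤w ∘ suc) A B)
  where
  head : ∀ a b → (if a then w zero else 0ℚ) ≤ (if a Bool.∨ b then w zero else 0ℚ)
  head true  _     = ℚ.≤-refl
  head false true  = 0≤w zero
  head false false = ℚ.≤-refl

weighted⇒monotone : ∀ {n} {χ : Game n} → Weighted χ → Monotone χ
weighted⇒monotone (w , q , 0≤w , wins⇔) U i U-wins =
  Equivalence.from (wins⇔ (U ∪ ⁅ i ⁆))
                   (ℚ.≤-trans (Equivalence.to (wins⇔ U) U-wins) (weightOf-∪ w 0≤w U ⁅ i ⁆))

weight-gap : ∀ {A B C w₁ w₂ q} → 0ℚ ≤ w₂ → 1ℚ + B ≤ C →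
             A * w₁ + C * w₂ ≤ q - 1ℚ → q ≤ (1ℚ + A) * w₁ + B * w₂ → w₂ + 1ℚ ≤ w₁
weight-gap {A} {B} {C} {w₁} {w₂} {q} 0≤w₂ 1+B≤C loser winner = begin
  w₂ + 1ℚ                                           ≡⟨ cancel-loser ⟩
  (A * w₁ + (1ℚ + B) * w₂ + 1ℚ) - (A * w₁ + B * w₂) ≤⟨ ℚ.+-monoˡ-≤ (ℚ.- (A * w₁ + B * w₂)) constraints ⟩
  ((1ℚ + A) * w₁ + B * w₂) - (A * w₁ + B * w₂)      ≡⟨ cancel-winner ⟩
  w₁                                                ∎
  where
  open ℚ.≤-Reasoning
  open +-*-Solver
  constraints : A * w₁ + (1ℚ + B) * w₂ + 1ℚ ≤ (1ℚ + A) * w₁ + B * w₂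
  constraints = begin
    A * w₁ + (1ℚ + B) * w₂ + 1ℚ ≤⟨ ℚ.+-monoˡ-≤ 1ℚ (ℚ.+-monoʳ-≤ (A * w₁)
                                     (ℚ.*-monoʳ-≤-nonNeg w₂ {{ℚ.nonNegative 0≤w₂}} 1+B≤C)) ⟩
    A * w₁ + C * w₂ + 1ℚ        ≤⟨ ℚ.+-monoˡ-≤ 1ℚ loser ⟩
    q - 1ℚ + 1ℚ                 ≡⟨ solve 1 (λ q → q :- con 1ℚ :+ con 1ℚ := q) refl q ⟩
    q                           ≤⟨ winner ⟩
    (1ℚ + A) * w₁ + B * w₂      ∎
  cancel-loser : w₂ + 1ℚ ≡ (A * w₁ + (1ℚ + B) * w₂ + 1ℚ) - (A * w₁ + B * w₂)
  cancel-loser = solve 4 (λ A B w₁ w₂ → w₂ :+ con 1ℚ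
                                       := (A :* w₁ :+ (con 1ℚ :+ B) :* w₂ :+ con 1ℚ) :- (A :* w₁ :+ B :* w₂))
                         refl A B w₁ w₂
  cancel-winner : ((1ℚ + A) * w₁ + B * w₂) - (A * w₁ + B * w₂) ≡ w₁
  cancel-winner = solve 4 (λ A B w₁ w₂ → ((con 1ℚ :+ A) :* w₁ :+ B :* w₂) :- (A :* w₁ :+ B :* w₂) := w₁)
                          refl A B w₁ w₂

mainTheorem15 : (n : ℕ) (χ : Game n) (N₁ : Subset n) →
    Weighted χ →
    TwoTypes χ N₁ →
    AtLeastTwoShiftMinWin χ N₁ →
    (∀ (i : Fin n) → ¬ Null χ i) →
    (w₁ w₂ q : ℚ) → 0ℚ ≤ w₁ → 0ℚ ≤ w₂ → 0ℚ ≤ q →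
    (∀ m₁ m₂ → ShiftMinWin χ N₁ (m₁ , m₂) → q ≤ ℕ→ℚ m₁ * w₁ + ℕ→ℚ m₂ * w₂) →
    (∀ l₁ l₂ → ShiftMaxLose χ N₁ (l₁ , l₂) → ℕ→ℚ l₁ * w₁ + ℕ→ℚ l₂ * w₂ ≤ q - 1ℚ) →
    w₂ + 1ℚ ≤ w₁
mainTheorem15 n χ N₁ weighted types two-winners _ w₁ w₂ q _ 0≤w₂ _ above-quota below-quota
  with shiftable-shiftMinWin {χ = χ} two-winners
... | a , b , winner , b<∣N₂∣
  with TwoTypeGame.losing-partner χ N₁ (weighted⇒monotone weighted) (twoTypes⇒homogeneousParts χ types)
                                  (twoTypes⇒dominant χ types) winner b<∣N₂∣
... | c , b<c , loser =
  weight-gap {ℕ→ℚ a} {ℕ→ℚ b} {ℕ→ℚ c} 0≤w₂ 1+b≤c (below-quota a c loser) winner-above-quota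
  where
  1+b≤c : 1ℚ + ℕ→ℚ b ≤ ℕ→ℚ c
  1+b≤c = subst (_≤ ℕ→ℚ c) (ℕ→ℚ-suc b) (ℕ→ℚ-mono-≤ b<c)
  winner-above-quota : q ≤ (1ℚ + ℕ→ℚ a) * w₁ + ℕ→ℚ b * w₂
  winner-above-quota = subst (λ x → q ≤ x * w₁ + ℕ→ℚ b * w₂) (ℕ→ℚ-suc a) (above-quota (ℕ.suc a) b winner)
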